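{- With an adversarially chosen initial coloring but uniformly random choice of conflicted vertices, the Persistent Decentralized Coloring algorithm requires $\Omega(n\Delta)$ expected recolorings in the worst case: there is an absolute constant $c>0$ such that for every $\Delta\ge 2$ there exist a graph $G$ with $n$ vertices and maximum degree $\Delta$ and an initial coloring $\chi_0:V(G)\to\{1,\dots,\Delta+1\}$ for which the expected number of recolorings performed by the algorithm started from $\chi_0$ is at least $c\,n\Delta$.
   Context: A vertex $v$ is conflicted under a coloring $\chi$ if some neighbor $u$ of $v$ has $\chi(u)=\chi(v)$. The Persistent Decentralized Coloring algorithm with a given initial coloring $\chi_0$ works as follows: at each time step a vertex $v$ is chosen uniformly at random among all currently conflicted vertices; while $v$ is conflicted, $v$ repeatedly changes its color to an independent uniformly random color in $\{1,\dots,\Delta+1\}$ (each change is one recoloring); this repeats until no vertex is conflicted. The expectation is over the random choices of conflicted vertices and the random new colors. -}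

module Defs where

open import Data.Bool using (Bool; true; false; if_then_else_; _∧_)
open import Data.Nat as ℕ using (ℕ; zero; suc)
open import Data.Fin using (Fin; _≟_)
open import Data.List using (List; []; _∷_; allFin; filterᵇ; length; map; foldr)
open import Data.Bool.ListAction using (any)
open import Data.Integer using (+_)
open import Data.Rational using (ℚ; _/_; _+_; _*_; 0ℚ; 1ℚ)
open import Relation.Nullary.Decidable using (⌊_⌋)
open import Relation.Binary.PropositionalEquality using (_≡_)
open import Data.Product using (_×_; Σ)

record Graph (n : ℕ) : Set where
  field
    adj     : Fin n → Fin n → Bool
    symm    : ∀ u v → adj u v ≡ adj v u
    irrefl  : ∀ v → adj v v ≡ false
open Graph public

degree : ∀ {n} → Graph n → Fin n → ℕ
degree {n} G v = length (filterᵇ (adj G v) (allFin n))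

MaxDegree : ∀ {n} → Graph n → ℕ → Set
MaxDegree {n} G Δ = (∀ v → degree G v ℕ.≤ Δ) × Σ (Fin n) (λ v → degree G v ≡ Δ)

-- Colorings with colors {1,…,Δ+1}, represented as Fin (suc Δ).
Coloring : ℕ → ℕ → Set
Coloring n Δ = Fin n → Fin (suc Δ)

eqᵇ : ∀ {m} → Fin m → Fin m → Bool
eqᵇ a b = ⌊ a ≟ b ⌋

conflicted : ∀ {n Δ} → Graph n → Coloring n Δ → Fin n → Bool
conflicted {n} G χ v = any (λ u → adj G v u ∧ eqᵇ (χ u) (χ v)) (allFin n)

conflictedVertices : ∀ {n Δ} → Graph n → Coloring n Δ → List (Fin n)
conflictedVertices {n} G χ = filterᵇ (conflicted G χ) (allFin n)

recolor : ∀ {n Δ} → Coloring n Δ → Fin n → Fin (suc Δ) → Coloring n Δ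
recolor χ v k u = if eqᵇ u v then k else χ u

sumℚ : List ℚ → ℚ
sumℚ = foldr _+_ 0ℚ

avg : List ℚ → ℚ
avg [] = 0ℚ
avg (x ∷ xs) = sumℚ (x ∷ xs) * (+ 1 / suc (length xs))

-- States of the Markov chain underlying the algorithm:
--   idle χ      : between time steps (a conflicted vertex is to be chosen);
--   working v χ : vertex v was chosen and keeps recolouring while conflicted.
data State (n Δ : ℕ) : Set where
  idle    : Coloring n Δ → State n Δ
  working : Fin n → Coloring n Δ → State n Δ

-- expRec G N s = expected number of recolourings performed during the
-- first N transitions of the chain started at s.  As N → ∞ this increases
-- to the expected total number of recolourings (monotone convergence).
expRec : ∀ {n Δ} → Graph n → ℕ → State n Δ → ℚ
expRec G zero s = 0ℚ
expRec G (suc N) (idle χ) =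
  avg (map (λ v → expRec G N (working v χ)) (conflictedVertices G χ))
expRec {Δ = Δ} G (suc N) (working v χ) =
  if conflicted G χ v
  then 1ℚ + avg (map (λ k → expRec G N (working v (recolor χ v k))) (allFin (suc Δ)))
  else expRec G N (idle χ)

-- "The expected number of recolourings from χ₀ is at least x" (the
-- expectation being the supremum of the truncated expectations; this also
-- covers an infinite expectation).
ExpectedRecoloringsAtLeast : ∀ {n Δ} → Graph n → Coloring n Δ → ℚ → Set
ExpectedRecoloringsAtLeast G χ₀ x =
  ∀ (q : ℚ) → q Data.Rational.< x → Σ ℕ (λ N → q Data.Rational.≤ expRec G N (idle χ₀))

module Submission where

-- For Δ = δ + 2 we build a graph with a = Δ - 1 anchors and p = ⌊δ/2⌋ + 1
-- pairs of adjacent members; every anchor is adjacent to every member.  Members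
-- have degree Δ, anchors degree 2p ≤ Δ, and n = a + 2p ≤ 4p.  Initially the
-- anchors get the distinct colours 2,…,Δ and all members the colour 1, so 0 is
-- the only colour free at a member.  A chosen member therefore recolours until
-- it draws 0, which takes Δ + 1 recolourings in expectation, and each pair is
-- resolved this way exactly once: about p·(Δ + 1) recolourings in total.
--
-- With K unresolved pairs, a simultaneous induction on the
-- horizon N shows that the truncated expectation is at least ½·min(N, K·(Δ+1))
-- (the factor ½ pays for the bookkeeping steps of the chain).  Starting from χ₀
-- this gives ½·p·(Δ+1) ≥ n·Δ/8, so the theorem holds with c = 1/8.

open import Defs
import Data.Nat
open import Data.Bool using (Bool; true; false; if_then_else_; _∧_; not; _xor_; T)
open import Data.Bool.Properties using (T-≡)
open import Data.Fin using (Fin; zero; suc; _↑ˡ_; _↑ʳ_; splitAt; _≟_)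
open import Data.List using (List; []; _∷_; allFin; filterᵇ; length; map; tabulate)
open import Data.List.Relation.Unary.All using (All; []; _∷_)
open import Data.Product using (Σ; _×_; _,_; proj₂)
open import Data.Sum using (_⊎_; inj₁; inj₂; [_,_]′)
open import Data.Empty using (⊥-elim)
open import Function using (_∘_)
open import Function.Bundles using (Equivalence)
open import Relation.Nullary using (¬_)
open import Relation.Binary.PropositionalEquality

module RationalFacts where
  open import Data.Nat as ℕ using (ℕ; zero; suc)
  import Data.Nat.Properties as ℕ
  open import Data.Nat.Coprimality using (1-coprimeTo) renaming (sym to coprime-sym)
  open import Data.Integer as ℤ using () renaming (+_ to ⁺_)
  open import Data.Rational
  open import Data.Rational.Properties
  open import Data.Rational.Solver using (module +-*-Solver)
  open +-*-Solver

  -- ι m = 1 + ⋯ + 1 + 0: the image of m in ℚ, defined by recursion so that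
  -- its compatibility with + , * and ≤ follows by induction.
  ι : ℕ → ℚ
  ι zero = 0ℚ
  ι (suc m) = 1ℚ + ι m

  ι-+ : ∀ a b → ι (a ℕ.+ b) ≡ ι a + ι b
  ι-+ zero b = sym (+-identityˡ (ι b))
  ι-+ (suc a) b = trans (cong (1ℚ +_) (ι-+ a b)) (sym (+-assoc 1ℚ (ι a) (ι b)))

  ι-* : ∀ a b → ι (a ℕ.* b) ≡ ι a * ι b
  ι-* zero b = sym (*-zeroˡ (ι b))
  ι-* (suc a) b = begin
      ι (b ℕ.+ a ℕ.* b) ≡⟨ ι-+ b (a ℕ.* b) ⟩
      ι b + ι (a ℕ.* b) ≡⟨ cong (ι b +_) (ι-* a b) ⟩
      ι b + ι a * ι b   ≡⟨ solve 2 (λ x y → y :+ x :* y := (con 1ℚ :+ x) :* y) refl (ι a) (ι b) ⟩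
      (1ℚ + ι a) * ι b  ∎
    where open ≡-Reasoning

  0≤1 : 0ℚ ≤ 1ℚ
  0≤1 = *≤* (ℤ.+≤+ ℕ.z≤n)

  ι-nonneg : ∀ a → 0ℚ ≤ ι a
  ι-nonneg zero = ≤-refl
  ι-nonneg (suc a) = +-mono-≤ 0≤1 (ι-nonneg a)

  ι-mono : ∀ {a b} → a ℕ.≤ b → ι a ≤ ι b
  ι-mono {a} {b} a≤b = begin
      ι a                ≡⟨ sym (+-identityʳ (ι a)) ⟩
      ι a + 0ℚ           ≤⟨ +-monoʳ-≤ (ι a) (ι-nonneg (b ℕ.∸ a)) ⟩
      ι a + ι (b ℕ.∸ a)  ≡⟨ sym (ι-+ a (b ℕ.∸ a)) ⟩
      ι (a ℕ.+ (b ℕ.∸ a)) ≡⟨ cong ι (ℕ.m+[n∸m]≡n a≤b) ⟩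
      ι b                ∎
    where open ≤-Reasoning

  integral : ℕ → ℚ
  integral m = mkℚ (⁺ m) 0 (coprime-sym (1-coprimeTo m))

  /1≡integral : ∀ m → ⁺ m / 1 ≡ integral m
  /1≡integral m = normalize-coprime (coprime-sym (1-coprimeTo m))

  ι≡integral : ∀ m → ι m ≡ integral m
  ι≡integral zero = refl
  ι≡integral (suc m) = trans (cong (1ℚ +_) (ι≡integral m)) (trans (/-cong {p₂ = ⁺ suc m} sum≡ refl) (/1≡integral (suc m)))
    where
    sum≡ : ⁺ 1 ℤ.* ⁺ 1 ℤ.+ ⁺ m ℤ.* ⁺ 1 ≡ ⁺ suc m
    sum≡ = cong (ℤ._+_ (⁺ 1)) (ℤ.*-identityʳ (⁺ m))
      where import Data.Integer.Properties as ℤ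

  ι≡/1 : ∀ m → ι m ≡ ⁺ m / 1
  ι≡/1 m = trans (ι≡integral m) (sym (/1≡integral m))

  ι-inverse : ∀ L → (⁺ 1 / suc L) * ι (suc L) ≡ 1ℚ
  ι-inverse L = trans (cong₂ _*_ (normalize-coprime (1-coprimeTo (suc L))) (ι≡integral (suc L)))
                      (*-inverseˡ (integral (suc L)))

  rescale : ∀ L t → t ≡ (ι (suc L) * t) * (⁺ 1 / suc L)
  rescale L t = begin
      t                                  ≡⟨ sym (*-identityʳ t) ⟩
      t * 1ℚ                             ≡⟨ cong (t *_) (sym (ι-inverse L)) ⟩
      t * ((⁺ 1 / suc L) * ι (suc L))    ≡⟨ solve 3 (λ t r i → t :* (r :* i) := (i :* t) :* r) refl t (⁺ 1 / suc L) (ι (suc L)) ⟩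
      (ι (suc L) * t) * (⁺ 1 / suc L)    ∎
    where open ≡-Reasoning

  sum-lb : ∀ t xs → All (t ≤_) xs → ι (length xs) * t ≤ sumℚ xs
  sum-lb t [] [] = ≤-reflexive (*-zeroˡ t)
  sum-lb t (x ∷ xs) (t≤x ∷ t≤xs) = begin
      (1ℚ + ι (length xs)) * t ≡⟨ solve 2 (λ a t → (con 1ℚ :+ a) :* t := t :+ a :* t) refl (ι (length xs)) t ⟩
      t + ι (length xs) * t    ≤⟨ +-mono-≤ t≤x (sum-lb t xs t≤xs) ⟩
      x + sumℚ xs              ∎
    where open ≤-Reasoning

  avg-lb : ∀ t xs → All (t ≤_) xs → ¬ xs ≡ [] → t ≤ avg xs
  avg-lb t [] _ nonempty = ⊥-elim (nonempty refl)
  avg-lb t (x ∷ xs) t≤xs _ = begin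
      t                                  ≡⟨ rescale (length xs) t ⟩
      (ι (suc (length xs)) * t) * r      ≤⟨ *-monoʳ-≤-nonNeg r {{normalize-nonNeg 1 (suc (length xs))}} (sum-lb t (x ∷ xs) t≤xs) ⟩
      sumℚ (x ∷ xs) * r                  ∎
    where
    open ≤-Reasoning
    r = ⁺ 1 / suc (length xs)

  avg-nonneg : ∀ xs → All (0ℚ ≤_) xs → 0ℚ ≤ avg xs
  avg-nonneg [] _ = ≤-refl
  avg-nonneg (x ∷ xs) 0≤xs = avg-lb 0ℚ (x ∷ xs) 0≤xs (λ ())

  -- One recolouring step: pay 1, then move to one of Δ+1 equally likely
  -- successors.
  recolouring-step : ∀ Δ m₀ m₁ m₂ (b : ℚ) (rest : List ℚ) → length rest ≡ Δ →
    suc Δ ℕ.* m₀ ℕ.≤ (suc Δ ℕ.+ suc Δ) ℕ.+ Δ ℕ.* m₁ ℕ.+ m₂ →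
    ½ * ι m₂ ≤ b → All (½ * ι m₁ ≤_) rest → ½ * ι m₀ ≤ 1ℚ + avg (b ∷ rest)
  recolouring-step Δ m₀ m₁ m₂ b rest refl budget b-lb rest-lb = begin
      ½ * ι m₀                                          ≡⟨ rescale Δ (½ * ι m₀) ⟩
      (ι d * (½ * ι m₀)) * r                            ≡⟨ cong (_* r) scaled ⟩
      (½ * ι (d ℕ.* m₀)) * r                            ≤⟨ *-monoʳ-≤-nonNeg r {{normalize-nonNeg 1 d}} (*-monoˡ-≤-nonNeg ½ (ι-mono budget)) ⟩
      (½ * ι ((d ℕ.+ d) ℕ.+ Δ ℕ.* m₁ ℕ.+ m₂)) * r       ≡⟨ cong (_* r) split ⟩
      (ι d + (½ * ι m₂ + ι Δ * (½ * ι m₁))) * r         ≤⟨ *-monoʳ-≤-nonNeg r {{normalize-nonNeg 1 d}} (+-monoʳ-≤ (ι d) (+-mono-≤ b-lb (sum-lb (½ * ι m₁) rest rest-lb))) ⟩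
      (ι d + (b + sumℚ rest)) * r                       ≡⟨ *-distribʳ-+ r (ι d) (b + sumℚ rest) ⟩
      ι d * r + (b + sumℚ rest) * r                     ≡⟨ cong (_+ (b + sumℚ rest) * r) (trans (*-comm (ι d) r) (ι-inverse Δ)) ⟩
      1ℚ + avg (b ∷ rest)                               ∎
    where
    open ≤-Reasoning
    d = suc Δ
    r = ⁺ 1 / suc Δ
    scaled : ι d * (½ * ι m₀) ≡ ½ * ι (d ℕ.* m₀)
    scaled = trans (solve 3 (λ a h b → a :* (h :* b) := h :* (a :* b)) refl (ι d) ½ (ι m₀)) (cong (½ *_) (sym (ι-* d m₀)))
    split : ½ * ι ((d ℕ.+ d) ℕ.+ Δ ℕ.* m₁ ℕ.+ m₂) ≡ ι d + (½ * ι m₂ + ι Δ * (½ * ι m₁))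
    split = trans (cong (½ *_) (trans (ι-+ ((d ℕ.+ d) ℕ.+ Δ ℕ.* m₁) m₂) (cong (_+ ι m₂) (trans (ι-+ (d ℕ.+ d) (Δ ℕ.* m₁)) (cong₂ _+_ (ι-+ d d) (ι-* Δ m₁))))))
          (solve 4 (λ x y z w → con ½ :* (((x :+ x) :+ y :* z) :+ w) := x :+ (con ½ :* w :+ y :* (con ½ :* z))) refl (ι d) (ι Δ) (ι m₁) (ι m₂))

module BooleanEquality where
  open import Relation.Nullary using (yes; no)
  open import Relation.Nullary.Decidable using (isYes≗does; dec-true; dec-false; toWitness)

  eqᵇ-refl : ∀ {m} (x : Fin m) → eqᵇ x x ≡ true
  eqᵇ-refl x = trans (isYes≗does (x ≟ x)) (dec-true (x ≟ x) refl)

  eqᵇ-≢ : ∀ {m} {x y : Fin m} → ¬ x ≡ y → eqᵇ x y ≡ false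
  eqᵇ-≢ {x = x} {y} x≢y = trans (isYes≗does (x ≟ y)) (dec-false (x ≟ y) x≢y)

  eqᵇ-≡ : ∀ {m} {x y : Fin m} → eqᵇ x y ≡ true → x ≡ y
  eqᵇ-≡ {x = x} {y} e = toWitness {a? = x ≟ y} (Equivalence.from T-≡ e)

  eqᵇ-sym : ∀ {m} (x y : Fin m) → eqᵇ x y ≡ eqᵇ y x
  eqᵇ-sym x y with x ≟ y
  ... | yes refl = sym (eqᵇ-refl x)
  ... | no x≢y = sym (eqᵇ-≢ (x≢y ∘ sym))

module Counting where
  open import Data.Nat using (ℕ; zero; suc; _+_)
  import Data.Fin.Properties as Fin
  open import Relation.Nullary using (yes; no)
  open BooleanEquality

  countTrue : ∀ {m} → (Fin m → Bool) → ℕ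
  countTrue {zero} f = 0
  countTrue {suc m} f = if f zero then suc (countTrue (f ∘ suc)) else countTrue (f ∘ suc)

  length-filter-tabulate : ∀ {A : Set} {m} (P : A → Bool) (f : Fin m → A) →
    length (filterᵇ P (tabulate f)) ≡ countTrue (P ∘ f)
  length-filter-tabulate {m = zero} P f = refl
  length-filter-tabulate {m = suc m} P f with P (f zero)
  ... | true = cong suc (length-filter-tabulate P (f ∘ suc))
  ... | false = length-filter-tabulate P (f ∘ suc)

  countTrue-cong : ∀ {m} {f g : Fin m → Bool} → (∀ i → f i ≡ g i) → countTrue f ≡ countTrue g
  countTrue-cong {zero} f≗g = refl
  countTrue-cong {suc m} {f} {g} f≗g rewrite f≗g zero =
    cong (λ k → if g zero then suc k else k) (countTrue-cong (f≗g ∘ suc))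

  countTrue-split : ∀ a {m} (f : Fin (a + m) → Bool) →
    countTrue f ≡ countTrue (λ i → f (i ↑ˡ m)) + countTrue (λ i → f (a ↑ʳ i))
  countTrue-split zero f = refl
  countTrue-split (suc a) f with f zero
  ... | true = cong suc (countTrue-split a (f ∘ suc))
  ... | false = countTrue-split a (f ∘ suc)

  countTrue-false : ∀ m → countTrue {m} (λ _ → false) ≡ 0
  countTrue-false zero = refl
  countTrue-false (suc m) = countTrue-false m

  countTrue-true : ∀ m → countTrue {m} (λ _ → true) ≡ m
  countTrue-true zero = refl
  countTrue-true (suc m) = cong suc (countTrue-true m)

  countTrue-eqᵇ : ∀ {m} (i : Fin m) → countTrue (eqᵇ i) ≡ 1
  countTrue-eqᵇ {suc m} zero =
    cong suc (trans (countTrue-cong {m} (λ j → eqᵇ-≢ {x = zero} {y = suc j} (λ ()))) (countTrue-false m))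
  countTrue-eqᵇ {suc m} (suc i) = trans (countTrue-cong shift) (countTrue-eqᵇ i)
    where
    shift : ∀ j → eqᵇ (suc i) (suc j) ≡ eqᵇ i j
    shift j with i ≟ j
    ... | yes _ = refl
    ... | no _ = refl

  countTrue-witness : ∀ {m} (f : Fin m → Bool) {k} → countTrue f ≡ suc k → Σ (Fin m) (λ i → f i ≡ true)
  countTrue-witness {zero} f ()
  countTrue-witness {suc m} f e with f zero in f0
  ... | true = zero , f0
  ... | false with countTrue-witness (f ∘ suc) e
  ...   | i , fi = suc i , fi

  countTrue-remove : ∀ {m} (f g : Fin m → Bool) (i₀ : Fin m) → f i₀ ≡ true → g i₀ ≡ false →
    (∀ i → ¬ i ≡ i₀ → f i ≡ g i) → countTrue f ≡ suc (countTrue g)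
  countTrue-remove {suc m} f g zero fi gi f≗g rewrite fi | gi =
    cong suc (countTrue-cong (λ i → f≗g (suc i) (λ ())))
  countTrue-remove {suc m} f g (suc i₀) fi gi f≗g rewrite f≗g zero (λ ()) =
    suc-under-if (g zero) (countTrue-remove (f ∘ suc) (g ∘ suc) i₀ fi gi (λ i i≢i₀ → f≗g (suc i) (i≢i₀ ∘ Fin.suc-injective)))
    where
    suc-under-if : ∀ b {x y} → x ≡ suc y → (if b then suc x else x) ≡ suc (if b then suc y else y)
    suc-under-if true refl = refl
    suc-under-if false refl = refl

module Conflicts {n Δ : Data.Nat.ℕ} (G : Graph n) where
  open import Data.List.Relation.Unary.Any using (satisfied)
  open import Data.List.Relation.Unary.Any.Properties using (any⁺; any⁻)
  open import Data.List.Relation.Unary.All.Properties using (all-filter)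
  open import Data.List.Membership.Propositional using (_∈_; lose)
  open import Data.List.Membership.Propositional.Properties using (∈-allFin; ∈-filter⁺)
  open import Data.Bool.Properties using (T-∧; T?)
  open BooleanEquality

  module _ (χ : Coloring n Δ) where
    conflicted-intro : ∀ {v} u → adj G v u ≡ true → χ u ≡ χ v → conflicted G χ v ≡ true
    conflicted-intro {v} u vu χu≡χv = Equivalence.to T-≡ (any⁺ _ (lose (∈-allFin u) witness))
      where
      witness : T (adj G v u ∧ eqᵇ (χ u) (χ v))
      witness = Equivalence.from T-∧
        (Equivalence.from T-≡ vu , Equivalence.from T-≡ (trans (cong (λ c → eqᵇ c (χ v)) χu≡χv) (eqᵇ-refl (χ v))))

    conflicted-elim : ∀ {v} → conflicted G χ v ≡ true → Σ (Fin n) (λ u → (adj G v u ≡ true) × (χ u ≡ χ v))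
    conflicted-elim {v} c with satisfied (any⁻ _ (allFin n) (Equivalence.from T-≡ c))
    ... | u , t with Equivalence.to T-∧ t
    ...   | vu , same = u , Equivalence.to T-≡ vu , eqᵇ-≡ (Equivalence.to T-≡ same)

    conflicted-false : ∀ {v} → (∀ u → adj G v u ≡ true → ¬ χ u ≡ χ v) → conflicted G χ v ≡ false
    conflicted-false {v} proper with conflicted G χ v in c
    ... | false = refl
    ... | true with conflicted-elim c
    ...   | u , vu , χu≡χv = ⊥-elim (proper u vu χu≡χv)

    conflictedVertices-nonempty : ∀ {A : Set} (f : Fin n → A) {v} → conflicted G χ v ≡ true →
                                  ¬ map f (conflictedVertices G χ) ≡ []
    conflictedVertices-nonempty f {v} c = nonempty (∈-filter⁺ (T? ∘ conflicted G χ) (∈-allFin v) (Equivalence.from T-≡ c))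
      where
      nonempty : ∀ {xs : List (Fin n)} → v ∈ xs → ¬ map f xs ≡ []
      nonempty {_ ∷ _} _ ()

    conflictedVertices-conflicted : All (T ∘ conflicted G χ) (conflictedVertices G χ)
    conflictedVertices-conflicted = all-filter (T? ∘ conflicted G χ) (allFin n)

  recolor-self : ∀ (χ : Coloring n Δ) v c → recolor χ v c v ≡ c
  recolor-self χ v c rewrite eqᵇ-refl v = refl

  recolor-other : ∀ (χ : Coloring n Δ) {u v} c → ¬ u ≡ v → recolor χ v c u ≡ χ u
  recolor-other χ c u≢v rewrite eqᵇ-≢ u≢v = refl

module Construction (δ : Data.Nat.ℕ) where
  open import Data.Nat as ℕ using (ℕ; zero; suc; _+_; ⌊_/2⌋; ⌈_/2⌉)
  import Data.Nat.Properties as ℕ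
  import Data.Fin.Properties as Fin
  open BooleanEquality
  open Counting

  a p n Δ : ℕ
  a = suc δ
  Δ = suc a
  p = suc ⌊ δ /2⌋
  n = a + (p + p)

  a≤2p : a ℕ.≤ p + p
  a≤2p = ℕ.s≤s (begin
      δ                          ≡⟨ sym (ℕ.⌊n/2⌋+⌈n/2⌉≡n δ) ⟩
      ⌊ δ /2⌋ + ⌈ δ /2⌉          ≤⟨ ℕ.+-monoʳ-≤ ⌊ δ /2⌋ (ℕ.⌊n/2⌋-mono (ℕ.n≤1+n (suc δ))) ⟩
      ⌊ δ /2⌋ + suc ⌊ δ /2⌋      ∎)
    where open ℕ.≤-Reasoning

  2p≤Δ : p + p ℕ.≤ Δ
  2p≤Δ = ℕ.s≤s (begin
      ⌊ δ /2⌋ + suc ⌊ δ /2⌋      ≡⟨ ℕ.+-suc ⌊ δ /2⌋ ⌊ δ /2⌋ ⟩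
      suc (⌊ δ /2⌋ + ⌊ δ /2⌋)    ≤⟨ ℕ.s≤s (ℕ.+-monoʳ-≤ ⌊ δ /2⌋ (ℕ.⌊n/2⌋≤⌈n/2⌉ δ)) ⟩
      suc (⌊ δ /2⌋ + ⌈ δ /2⌉)    ≡⟨ cong suc (ℕ.⌊n/2⌋+⌈n/2⌉≡n δ) ⟩
      suc δ                      ∎)
    where open ℕ.≤-Reasoning

  data Role : Set where
    anchor : Fin a → Role
    member : Bool → Fin p → Role

  adjRole : Role → Role → Bool
  adjRole (anchor _) (anchor _) = false
  adjRole (anchor _) (member _ _) = true
  adjRole (member _ _) (anchor _) = true
  adjRole (member s i) (member t j) = (s xor t) ∧ eqᵇ i j

  adjRole-sym : ∀ r r' → adjRole r r' ≡ adjRole r' r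
  adjRole-sym (anchor _) (anchor _) = refl
  adjRole-sym (anchor _) (member _ _) = refl
  adjRole-sym (member _ _) (anchor _) = refl
  adjRole-sym (member s i) (member t j) = cong₂ _∧_ (xor-comm s t) (eqᵇ-sym i j)
    where open import Data.Bool.Properties using (xor-comm)

  adjRole-irrefl : ∀ r → adjRole r r ≡ false
  adjRole-irrefl (anchor _) = refl
  adjRole-irrefl (member false i) = refl
  adjRole-irrefl (member true i) = refl

  adjRole-members : ∀ s t (i j : Fin p) → adjRole (member s i) (member t j) ≡ true → (t ≡ not s) × (j ≡ i)
  adjRole-members false true i j e = refl , sym (eqᵇ-≡ e)
  adjRole-members true false i j e = refl , sym (eqᵇ-≡ e)

  anchorV : Fin a → Fin n
  anchorV j = j ↑ˡ (p + p)

  memberV : Bool → Fin p → Fin n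
  memberV false i = a ↑ʳ (i ↑ˡ p)
  memberV true i = a ↑ʳ (p ↑ʳ i)

  role : Fin n → Role
  role v = [ anchor , (λ w → [ member false , member true ]′ (splitAt p w)) ]′ (splitAt a v)

  role-anchorV : ∀ j → role (anchorV j) ≡ anchor j
  role-anchorV j rewrite Fin.splitAt-↑ˡ a j (p + p) = refl

  role-memberV : ∀ s i → role (memberV s i) ≡ member s i
  role-memberV false i rewrite Fin.splitAt-↑ʳ a (p + p) (i ↑ˡ p) | Fin.splitAt-↑ˡ p i p = refl
  role-memberV true i rewrite Fin.splitAt-↑ʳ a (p + p) (p ↑ʳ i) | Fin.splitAt-↑ʳ p p i = refl

  data View : Fin n → Set where
    is-anchor : ∀ j → View (anchorV j)
    is-member : ∀ s i → View (memberV s i)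

  view : ∀ v → View v
  view v with splitAt a v in e
  ... | inj₁ j = subst View (Fin.splitAt⁻¹-↑ˡ e) (is-anchor j)
  ... | inj₂ w with splitAt p w in e'
  ...   | inj₁ i = subst View (trans (cong (a ↑ʳ_) (Fin.splitAt⁻¹-↑ˡ e')) (Fin.splitAt⁻¹-↑ʳ e)) (is-member false i)
  ...   | inj₂ i = subst View (trans (cong (a ↑ʳ_) (Fin.splitAt⁻¹-↑ʳ e')) (Fin.splitAt⁻¹-↑ʳ e)) (is-member true i)

  memberV-injective : ∀ {s t i j} → memberV s i ≡ memberV t j → (s ≡ t) × (i ≡ j)
  memberV-injective {s} {t} {i} {j} e with trans (sym (role-memberV s i)) (trans (cong role e) (role-memberV t j))
  ... | refl = refl , refl

  anchorV≢memberV : ∀ {j s i} → ¬ anchorV j ≡ memberV s i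
  anchorV≢memberV {j} {s} {i} e with trans (sym (role-anchorV j)) (trans (cong role e) (role-memberV s i))
  ... | ()

  partner≢ : ∀ s i → ¬ memberV (not s) i ≡ memberV s i
  partner≢ false i e with memberV-injective {true} {false} {i} {i} e
  ... | () , _
  partner≢ true i e with memberV-injective {false} {true} {i} {i} e
  ... | () , _

  otherPair≢ : ∀ {s t i i'} → ¬ i' ≡ i → ¬ memberV t i' ≡ memberV s i
  otherPair≢ {s} {t} {i} {i'} i'≢i e = i'≢i (proj₂ (memberV-injective {t} {s} {i'} {i} e))

  G : Graph n
  G = record
    { adj = λ u v → adjRole (role u) (role v)
    ; symm = λ u v → adjRole-sym (role u) (role v)
    ; irrefl = λ v → adjRole-irrefl (role v)
    }

  degreeRole : Role → ℕ
  degreeRole r = countTrue (adjRole r ∘ anchor) + (countTrue (adjRole r ∘ member false) + countTrue (adjRole r ∘ member true))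

  degree≡degreeRole : ∀ v → degree G v ≡ degreeRole (role v)
  degree≡degreeRole v = begin
      degree G v
        ≡⟨ length-filter-tabulate (adj G v) (λ u → u) ⟩
      countTrue (adj G v)
        ≡⟨ countTrue-split a (adj G v) ⟩
      countTrue (adj G v ∘ anchorV) + countTrue (λ w → adj G v (a ↑ʳ w))
        ≡⟨ cong (countTrue (adj G v ∘ anchorV) +_) (countTrue-split p (λ w → adj G v (a ↑ʳ w))) ⟩
      countTrue (adj G v ∘ anchorV) + (countTrue (adj G v ∘ memberV false) + countTrue (adj G v ∘ memberV true))
        ≡⟨ cong₂ _+_ (byRole {f = anchorV} role-anchorV) (cong₂ _+_ (byRole {f = memberV false} (role-memberV false)) (byRole {f = memberV true} (role-memberV true))) ⟩
      degreeRole (role v) ∎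
    where
    open ≡-Reasoning
    byRole : ∀ {k} {f : Fin k → Fin n} {g : Fin k → Role} → (∀ i → role (f i) ≡ g i) →
             countTrue (adj G v ∘ f) ≡ countTrue (adjRole (role v) ∘ g)
    byRole roles = countTrue-cong (λ i → cong (adjRole (role v)) (roles i))

  -- A member sees all a anchors and its partner.
  degree-member : ∀ s i → degreeRole (member s i) ≡ Δ
  degree-member false i = trans (cong₂ _+_ (countTrue-true a) (cong₂ _+_ (countTrue-false p) (countTrue-eqᵇ i))) (ℕ.+-comm a 1)
  degree-member true i = trans (cong₂ _+_ (countTrue-true a) (cong₂ _+_ (countTrue-eqᵇ i) (countTrue-false p))) (ℕ.+-comm a 1)

  degree-anchor : ∀ j → degreeRole (anchor j) ≡ p + p
  degree-anchor j = cong₂ _+_ (countTrue-false a) (cong₂ _+_ (countTrue-true p) (countTrue-true p))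

  maxDegree : MaxDegree G Δ
  maxDegree = bounded , memberV false zero , trans (degree≡degreeRole (memberV false zero)) (trans (cong degreeRole (role-memberV false zero)) (degree-member false zero))
    where
    bounded : ∀ v → degree G v ℕ.≤ Δ
    bounded v rewrite degree≡degreeRole v with view v
    ... | is-anchor j rewrite role-anchorV j | degree-anchor j = 2p≤Δ
    ... | is-member s i rewrite role-memberV s i | degree-member s i = ℕ.≤-refl

  -- Colours: 0 is the free colour, 1 is shared by all members, anchors get 2,…,Δ.
  Colour : Set
  Colour = Fin (suc Δ)

  shared : Colour
  shared = suc zero

  anchorColour : Fin a → Colour
  anchorColour j = suc (suc j)

  roleColour : Role → Colour
  roleColour (anchor j) = anchorColour j
  roleColour (member _ _) = shared

  χ₀ : Coloring n Δ
  χ₀ v = roleColour (role v)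

module Invariants (δ : Data.Nat.ℕ) where
  open import Data.Nat using (ℕ; zero; suc)
  open import Relation.Nullary using (yes; no)
  open Construction δ
  open Conflicts {n} {Δ} G
  open Counting
  open BooleanEquality

  nonzero : Colour → Bool
  nonzero zero = false
  nonzero (suc _) = true

  -- Pair i is unresolved while neither member has the free colour 0;
  -- the number of unresolved pairs is the potential driving the bound.
  unresolvedAt : Coloring n Δ → Fin p → Bool
  unresolvedAt χ i = nonzero (χ (memberV false i)) ∧ nonzero (χ (memberV true i))

  unresolved : Coloring n Δ → ℕ
  unresolved χ = countTrue (unresolvedAt χ)

  AnchorsFixed : Coloring n Δ → Set
  AnchorsFixed χ = ∀ j → χ (anchorV j) ≡ anchorColour j

  PairInv : Coloring n Δ → Fin p → Set
  PairInv χ i = (∀ t → χ (memberV t i) ≡ shared)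
              ⊎ Σ Bool (λ t → (χ (memberV t i) ≡ zero) × (χ (memberV (not t) i) ≡ shared))

  Idle : Coloring n Δ → Set
  Idle χ = AnchorsFixed χ × (∀ i → PairInv χ i)

  record Active (v : Fin n) (χ : Coloring n Δ) : Set where
    field
      anchorsFixed  : AnchorsFixed χ
      side          : Bool
      pair          : Fin p
      v≡member      : v ≡ memberV side pair
      partnerShared : χ (memberV (not side) pair) ≡ shared
      v-nonzero     : ¬ χ v ≡ zero
      otherPairs    : ∀ i → ¬ i ≡ pair → PairInv χ i

  adj-partner : ∀ s i → adj G (memberV s i) (memberV (not s) i) ≡ true
  adj-partner s i rewrite role-memberV s i | role-memberV (not s) i = partner s
    where
    partner : ∀ s → adjRole (member s i) (member (not s) i) ≡ true
    partner false = eqᵇ-refl i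
    partner true = eqᵇ-refl i

  adj-anchor : ∀ s i j → adj G (memberV s i) (anchorV j) ≡ true
  adj-anchor s i j rewrite role-memberV s i | role-anchorV j = refl

  adj-members : ∀ s i t j → adj G (memberV s i) (memberV t j) ≡ true → (t ≡ not s) × (j ≡ i)
  adj-members s i t j e rewrite role-memberV s i | role-memberV t j = adjRole-members s t i j e

  anchors-independent : ∀ j j' → ¬ adj G (anchorV j) (anchorV j') ≡ true
  anchors-independent j j' e rewrite role-anchorV j | role-anchorV j' with e
  ... | ()

  memberColour : ∀ {χ : Coloring n Δ} {i} → PairInv χ i → ∀ t → (χ (memberV t i) ≡ zero) ⊎ (χ (memberV t i) ≡ shared)
  memberColour (inj₁ untouched) t = inj₂ (untouched t)
  memberColour (inj₂ (false , z , s)) false = inj₁ z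
  memberColour (inj₂ (false , z , s)) true = inj₂ s
  memberColour (inj₂ (true , z , s)) false = inj₂ s
  memberColour (inj₂ (true , z , s)) true = inj₁ z

  notAnchorColour : ∀ {x : Colour} j → (x ≡ zero) ⊎ (x ≡ shared) → ¬ x ≡ anchorColour j
  notAnchorColour j (inj₁ refl) ()
  notAnchorColour j (inj₂ refl) ()

  resolved-proper : ∀ {χ : Coloring n Δ} {i} (t s : Bool) → χ (memberV t i) ≡ zero → χ (memberV (not t) i) ≡ shared →
                    ¬ χ (memberV (not s) i) ≡ χ (memberV s i)
  resolved-proper false false z sh e with trans (sym sh) (trans e z)
  ... | ()
  resolved-proper false true z sh e with trans (sym z) (trans e sh)
  ... | ()
  resolved-proper true false z sh e with trans (sym z) (trans e sh)
  ... | ()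
  resolved-proper true true z sh e with trans (sym sh) (trans e z)
  ... | ()

  pairInv-transfer : ∀ (χ χ' : Coloring n Δ) i → (∀ t → χ' (memberV t i) ≡ χ (memberV t i)) → PairInv χ i → PairInv χ' i
  pairInv-transfer χ χ' i same (inj₁ untouched) = inj₁ (λ t → trans (same t) (untouched t))
  pairInv-transfer χ χ' i same (inj₂ (t , z , sh)) = inj₂ (t , trans (same t) z , trans (same (not t)) sh)

  unresolvedAt-true : ∀ {f : Bool → Bool} s → f s ≡ true → f (not s) ≡ true → f false ∧ f true ≡ true
  unresolvedAt-true false e e' rewrite e | e' = refl
  unresolvedAt-true true e e' rewrite e | e' = refl

  unresolvedAt-false : ∀ {f : Bool → Bool} s → f s ≡ false → f false ∧ f true ≡ false
  unresolvedAt-false false e rewrite e = refl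
  unresolvedAt-false {f} true e rewrite e with f false
  ... | true = refl
  ... | false = refl

  nonzero-true : ∀ {c : Colour} → ¬ c ≡ zero → nonzero c ≡ true
  nonzero-true {zero} c≢0 = ⊥-elim (c≢0 refl)
  nonzero-true {suc c} _ = refl

  -- An active vertex is conflicted: its colour is either shared (so it
  -- clashes with its partner) or an anchor colour (so it clashes with that anchor).
  active-conflicted : ∀ {v χ} → Active v χ → conflicted G χ v ≡ true
  active-conflicted {χ = χ} record { anchorsFixed = anchors ; side = s ; pair = i ; v≡member = refl
                                   ; partnerShared = partner ; v-nonzero = v≢0 } = byColour (χ (memberV s i)) refl
    where
    byColour : ∀ c → χ (memberV s i) ≡ c → conflicted G χ (memberV s i) ≡ true
    byColour zero e = ⊥-elim (v≢0 e)
    byColour (suc zero) e = conflicted-intro χ (memberV (not s) i) (adj-partner s i) (trans partner (sym e))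
    byColour (suc (suc j)) e = conflicted-intro χ (anchorV j) (adj-anchor s i j) (trans (anchors j) (sym e))

  active-recolor : ∀ {v χ c} → Active v χ → ¬ c ≡ zero → Active v (recolor χ v c)
  active-recolor {χ = χ} {c} record { anchorsFixed = anchors ; side = s ; pair = i ; v≡member = refl
                                    ; partnerShared = partner ; otherPairs = others } c≢0 = record
    { anchorsFixed = λ j → trans (recolor-other χ c (anchorV≢memberV {j} {s} {i})) (anchors j)
    ; side = s
    ; pair = i
    ; v≡member = refl
    ; partnerShared = trans (recolor-other χ c (partner≢ s i)) partner
    ; v-nonzero = λ e → c≢0 (trans (sym (recolor-self χ (memberV s i) c)) e)
    ; otherPairs = λ i' i'≢i → pairInv-transfer χ (recolor χ (memberV s i) c) i' (λ t → recolor-other χ c (otherPair≢ {s} {t} {i} {i'} i'≢i)) (others i' i'≢i)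
    }

  active-recolor-unresolved : ∀ {v χ c} → Active v χ → ¬ c ≡ zero → unresolved (recolor χ v c) ≡ unresolved χ
  active-recolor-unresolved {v} {χ} {c} act c≢0 =
    countTrue-cong (λ i → cong₂ _∧_ (same (memberV false i)) (same (memberV true i)))
    where
    same : ∀ u → nonzero (recolor χ v c u) ≡ nonzero (χ u)
    same u with u ≟ v
    ... | yes refl = trans (nonzero-true c≢0) (sym (nonzero-true (Active.v-nonzero act)))
    ... | no _ = refl

  -- Recolouring an active vertex with 0 resolves its pair: the vertex is no
  -- longer conflicted (0 is free at members) …
  resolve-proper : ∀ {v χ} → Active v χ → conflicted G (recolor χ v zero) v ≡ false
  resolve-proper {χ = χ} record { anchorsFixed = anchors ; side = s ; pair = i ; v≡member = refl
                                ; partnerShared = partner } = conflicted-false χ' proper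
    where
    χ' = recolor χ (memberV s i) zero
    v↦0 : χ' (memberV s i) ≡ zero
    v↦0 = recolor-self χ (memberV s i) zero
    proper : ∀ u → adj G (memberV s i) u ≡ true → ¬ χ' u ≡ χ' (memberV s i)
    proper u vu with view u
    ... | is-anchor j = λ q → anchor≢0 (trans (sym (trans (recolor-other χ zero (anchorV≢memberV {j} {s} {i})) (anchors j))) (trans q v↦0))
      where
      anchor≢0 : ¬ anchorColour j ≡ zero
      anchor≢0 ()
    ... | is-member t j with adj-members s i t j vu
    ...   | refl , refl = λ q → shared≢0 (trans (sym (trans (recolor-other χ zero (partner≢ s i)) partner)) (trans q v↦0))
      where
      shared≢0 : ¬ shared ≡ zero
      shared≢0 ()

  resolve-idle : ∀ {v χ} → Active v χ → Idle (recolor χ v zero)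
  resolve-idle {χ = χ} record { anchorsFixed = anchors ; side = s ; pair = i ; v≡member = refl
                              ; partnerShared = partner ; otherPairs = others } =
    (λ j → trans (recolor-other χ zero (anchorV≢memberV {j} {s} {i})) (anchors j)) , pairs
    where
    pairs : ∀ i' → PairInv (recolor χ (memberV s i) zero) i'
    pairs i' with i' ≟ i
    ... | yes refl = inj₂ (s , recolor-self χ (memberV s i) zero , trans (recolor-other χ zero (partner≢ s i)) partner)
    ... | no i'≢i = pairInv-transfer χ (recolor χ (memberV s i) zero) i' (λ t → recolor-other χ zero (otherPair≢ {s} {t} {i} {i'} i'≢i)) (others i' i'≢i)

  resolve-unresolved : ∀ {v χ} → Active v χ → unresolved χ ≡ suc (unresolved (recolor χ v zero))
  resolve-unresolved {χ = χ} record { side = s ; pair = i ; v≡member = refl ; partnerShared = partner ; v-nonzero = v≢0 } =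
    countTrue-remove (unresolvedAt χ) (unresolvedAt χ') i
      (unresolvedAt-true {λ t → nonzero (χ (memberV t i))} s (nonzero-true v≢0) (cong nonzero partner))
      (unresolvedAt-false {λ t → nonzero (χ' (memberV t i))} s (cong nonzero (recolor-self χ (memberV s i) zero)))
      (λ i' i'≢i → cong₂ _∧_ (untouched false i'≢i) (untouched true i'≢i))
    where
    χ' = recolor χ (memberV s i) zero
    untouched : ∀ t {i'} → ¬ i' ≡ i → nonzero (χ (memberV t i')) ≡ nonzero (χ' (memberV t i'))
    untouched t i'≢i = cong nonzero (sym (recolor-other χ zero (otherPair≢ {s} {t} {i} i'≢i)))

  idle-active : ∀ {v χ} → Idle χ → conflicted G χ v ≡ true → Active v χ
  idle-active {v} {χ} (anchors , pairs) c with conflicted-elim χ c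
  ... | u , vu , χu≡χv with view v | view u
  ... | is-anchor j | is-anchor j' = ⊥-elim (anchors-independent j j' vu)
  ... | is-anchor j | is-member t i = ⊥-elim (notAnchorColour j (memberColour {χ} {i} (pairs i) t) (trans χu≡χv (anchors j)))
  ... | is-member s i | is-anchor j = ⊥-elim (notAnchorColour j (memberColour {χ} {i} (pairs i) s) (trans (sym χu≡χv) (anchors j)))
  ... | is-member s i | is-member t j with adj-members s i t j vu
  ...   | refl , refl = untouched (pairs i)
    where
    untouched : PairInv χ i → Active (memberV s i) χ
    untouched (inj₂ (t₀ , z , sh)) = ⊥-elim (resolved-proper {χ} {i} t₀ s z sh χu≡χv)
    untouched (inj₁ allShared) = record
      { anchorsFixed = anchors ; side = s ; pair = i ; v≡member = refl
      ; partnerShared = allShared (not s)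
      ; v-nonzero = λ z → shared≢0 (trans (sym (allShared s)) z)
      ; otherPairs = λ i' _ → pairs i'
      }
      where
      shared≢0 : ¬ shared ≡ zero
      shared≢0 ()

  idle-progress : ∀ {χ k} → Idle χ → unresolved χ ≡ suc k → Σ (Fin n) (λ v → conflicted G χ v ≡ true)
  idle-progress {χ} (anchors , pairs) e with countTrue-witness (unresolvedAt χ) e
  ... | i , live with pairs i
  ...   | inj₁ allShared = memberV false i , conflicted-intro χ (memberV true i) (adj-partner false i) (trans (allShared true) (sym (allShared false)))
  ...   | inj₂ (t , z , _) with trans (sym live) (unresolvedAt-false {λ t → nonzero (χ (memberV t i))} t (cong nonzero z))
  ...     | ()

  χ₀-idle : Idle χ₀
  χ₀-idle = (λ j → cong roleColour (role-anchorV j)) , (λ i → inj₁ (λ t → cong roleColour (role-memberV t i)))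

  χ₀-unresolved : unresolved χ₀ ≡ p
  χ₀-unresolved = trans (countTrue-cong live) (countTrue-true p)
    where
    live : ∀ i → unresolvedAt χ₀ i ≡ true
    live i rewrite role-memberV false i | role-memberV true i = refl

module Nonnegativity where
  open import Data.Nat using (ℕ; zero; suc)
  open import Data.Rational using (_≤_; 0ℚ; 1ℚ)
  open import Data.Rational.Properties using (≤-refl; +-mono-≤)
  open import Data.List.Relation.Unary.All using (universal)
  open import Data.List.Relation.Unary.All.Properties using (map⁺)
  open RationalFacts using (0≤1; avg-nonneg)

  expRec-nonneg : ∀ {n Δ} (G : Graph n) N (s : State n Δ) → 0ℚ ≤ expRec G N s
  expRec-nonneg G zero s = ≤-refl
  expRec-nonneg G (suc N) (idle χ) = avg-nonneg _ (map⁺ (universal (λ v → expRec-nonneg G N _) (conflictedVertices G χ)))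
  expRec-nonneg {Δ = Δ} G (suc N) (working v χ) with conflicted G χ v
  ... | true = +-mono-≤ 0≤1 (avg-nonneg _ (map⁺ (universal (λ c → expRec-nonneg G N _) (allFin (suc Δ)))))
  ... | false = expRec-nonneg G N (idle χ)

-- The arithmetic behind one recolouring step of an active vertex with k + 1
-- unresolved pairs: the budget min(N+1, (k+1)(Δ+1)) of the next horizon is
-- covered by two steps of overhead, Δ equally likely continuations with the
-- same potential, and one continuation that resolves the pair.
module StepBudget where
  open import Data.Nat
  open import Data.Nat.Properties
  open import Data.Nat.Solver using (module +-*-Solver)
  open +-*-Solver

  step-budget : ∀ Δ N k → 1 ≤ Δ →
    suc Δ * (suc N ⊓ (suc k * suc Δ)) ≤ (suc Δ + suc Δ) + Δ * (N ⊓ (suc k * suc Δ)) + ((N ∸ 2) ⊓ (k * suc Δ))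
  step-budget Δ N k 1≤Δ = begin
      d * m₀                       ≡⟨⟩
      m₀ + Δ * m₀                  ≤⟨ +-monoʳ-≤ m₀ (*-monoʳ-≤ Δ m₀≤1+m₁) ⟩
      m₀ + Δ * suc m₁              ≡⟨ cong (m₀ +_) (*-suc Δ m₁) ⟩
      m₀ + (Δ + Δ * m₁)            ≤⟨ +-monoˡ-≤ (Δ + Δ * m₁) m₀≤ ⟩
      (suc d + m₂) + (Δ + Δ * m₁)  ≡⟨ solve 3 (λ D M₁ M₂ → (con 2 :+ D :+ M₂) :+ (D :+ D :* M₁) := (con 1 :+ D :+ (con 1 :+ D)) :+ D :* M₁ :+ M₂) refl Δ m₁ m₂ ⟩
      (d + d) + Δ * m₁ + m₂        ∎
    where
    open ≤-Reasoning
    d = suc Δ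
    cap = suc k * d
    m₀ = suc N ⊓ cap
    m₁ = N ⊓ cap
    m₂ = (N ∸ 2) ⊓ (k * d)
    m₀≤1+m₁ : m₀ ≤ suc m₁
    m₀≤1+m₁ = ⊓-glb (m⊓n≤m (suc N) cap) (≤-trans (m⊓n≤n (suc N) cap) (n≤1+n cap))
    m₀≤ : m₀ ≤ suc d + m₂
    m₀≤ = ≤-trans (⊓-glb (≤-trans (m⊓n≤m (suc N) cap) N-part) (≤-trans (m⊓n≤n (suc N) cap) (n≤1+n cap))) (≤-reflexive (sym (+-distribˡ-⊓ (suc d) (N ∸ 2) (k * d))))
      where
      N-part : suc N ≤ suc d + (N ∸ 2)
      N-part = s≤s (≤-trans (m≤n+m∸n N 2) (+-monoˡ-≤ (N ∸ 2) (s≤s 1≤Δ)))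

module LowerBound (δ : Data.Nat.ℕ) where
  open import Data.Nat as ℕ using (ℕ; zero; suc; _⊓_; _∸_; _+_; _*_; s≤s; z≤n)
  import Data.Nat.Properties as ℕ
  open import Data.Integer using () renaming (+_ to ⁺_)
  open import Data.Rational as ℚ using (ℚ; ½; 1ℚ; _/_)
  open import Data.Rational.Properties using (≤-refl; *-monoˡ-≤-nonNeg; *-assoc; module ≤-Reasoning)
  open import Data.List.Properties using (length-map; length-tabulate)
  import Data.List.Relation.Unary.All as All
  open import Data.List.Relation.Unary.All.Properties using (map⁺; tabulate⁺)
  open RationalFacts
  open Nonnegativity
  open StepBudget
  open Construction δ
  open Conflicts {n} {Δ} G
  open Invariants δ

  d : ℕ
  d = suc Δ

  half : ℕ → ℚ
  half m = ½ ℚ.* ι m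

  -- With K unresolved pairs, the truncated expectation over horizon N is at
  -- least ½·min(N, K·(Δ+1)), with a shift of the horizon by the bookkeeping
  -- steps: 0 for an active vertex, 1 between steps, 2 right after resolving.
  activeBound : ∀ N K {v χ} → Active v χ → unresolved χ ≡ K → half (N ⊓ (K * d)) ℚ.≤ expRec G N (working v χ)
  idleBound : ∀ N K {χ} → Idle χ → unresolved χ ≡ K → half ((N ∸ 1) ⊓ (K * d)) ℚ.≤ expRec G N (idle χ)
  resolvedBound : ∀ N K {v χ} → Active v χ → unresolved (recolor χ v zero) ≡ K →
                  half ((N ∸ 2) ⊓ (K * d)) ℚ.≤ expRec G N (working v (recolor χ v zero))

  -- An active vertex recolours: with probability 1/(Δ+1) it draws 0 and
  -- resolves its pair, otherwise it stays active with the same potential.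
  activeBound zero K act e = ≤-refl
  activeBound (suc N) zero act e = ⊥-elim (ℕ.1+n≢0 (trans (sym (resolve-unresolved act)) e))
  activeBound (suc N) (suc k) {v} {χ} act e rewrite active-conflicted act =
    recolouring-step Δ (suc N ⊓ (suc k * d)) (N ⊓ (suc k * d)) ((N ∸ 2) ⊓ (k * d)) (next zero) (map next (tabulate suc))
      (trans (length-map next (tabulate suc)) (length-tabulate suc))
      (step-budget Δ N k (s≤s z≤n)) resolved stillActive
    where
    next : Fin (suc Δ) → ℚ
    next c = expRec G N (working v (recolor χ v c))
    resolved : half ((N ∸ 2) ⊓ (k * d)) ℚ.≤ next zero
    resolved = resolvedBound N k act (ℕ.suc-injective (trans (sym (resolve-unresolved act)) e))
    stillActive : All (half (N ⊓ (suc k * d)) ℚ.≤_) (map next (tabulate suc))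
    stillActive = map⁺ (tabulate⁺ {f = suc} (λ c →
      activeBound N (suc k) (active-recolor act (λ ())) (trans (active-recolor-unresolved act (λ ())) e)))

  -- Between steps some conflicted vertex is chosen; each one becomes active.
  idleBound zero K inv e = ≤-refl
  idleBound (suc N) zero {χ} inv e rewrite ℕ.⊓-zeroʳ N =
    avg-nonneg _ (map⁺ (All.universal (λ v → expRec-nonneg G N (working v χ)) (conflictedVertices G χ)))
  idleBound (suc N) (suc k) {χ} inv e with idle-progress inv e
  ... | v , c = avg-lb _ _
    (map⁺ (All.map (λ cu → activeBound N (suc k) (idle-active inv (Equivalence.to T-≡ cu)) e) (conflictedVertices-conflicted χ)))
    (conflictedVertices-nonempty χ (λ u → expRec G N (working u χ)) c)

  -- Right after drawing 0 the vertex is no longer conflicted and the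
  -- chain returns to the idle state.
  resolvedBound zero K act e = ≤-refl
  resolvedBound (suc N) K act e rewrite resolve-proper act = idleBound N K (resolve-idle act) e

  initialBound : half (p * d) ℚ.≤ expRec G (suc (p * d)) (idle χ₀)
  initialBound = subst (λ m → half m ℚ.≤ expRec G (suc (p * d)) (idle χ₀)) (ℕ.⊓-idem (p * d))
                       (idleBound (suc (p * d)) p χ₀-idle χ₀-unresolved)

  size-bound : n * Δ ℕ.≤ 4 * (p * d)
  size-bound = ℕ.≤-trans (ℕ.*-mono-≤ (ℕ.+-monoˡ-≤ (p + p) a≤2p) (ℕ.n≤1+n Δ)) (ℕ.≤-reflexive (solve 2 (λ P D → ((P :+ P) :+ (P :+ P)) :* D := con 4 :* (P :* D)) refl p d))
    where
    open import Data.Nat.Solver using (module +-*-Solver)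
    open +-*-Solver

  eighth-bound : (⁺ 1 / 8) ℚ.* (⁺ (n * Δ) / 1) ℚ.≤ expRec G (suc (p * d)) (idle χ₀)
  eighth-bound = begin
      (⁺ 1 / 8) ℚ.* (⁺ (n * Δ) / 1)         ≡⟨ cong ((⁺ 1 / 8) ℚ.*_) (sym (ι≡/1 (n * Δ))) ⟩
      (⁺ 1 / 8) ℚ.* ι (n * Δ)               ≤⟨ *-monoˡ-≤-nonNeg (⁺ 1 / 8) (ι-mono size-bound) ⟩
      (⁺ 1 / 8) ℚ.* ι (4 * (p * d))         ≡⟨ cong ((⁺ 1 / 8) ℚ.*_) (ι-* 4 (p * d)) ⟩
      (⁺ 1 / 8) ℚ.* (ι 4 ℚ.* ι (p * d))     ≡⟨ sym (*-assoc (⁺ 1 / 8) (ι 4) (ι (p * d))) ⟩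
      half (p * d)                          ≤⟨ initialBound ⟩
      expRec G (suc (p * d)) (idle χ₀)      ∎
    where open ≤-Reasoning

open import Defs
open import Data.Nat using (ℕ; suc; _≤_)
open import Data.Fin using (Fin)
open import Data.Product using (Σ; _×_)
open import Data.Integer using (+_)
open import Data.Rational using (ℚ; _<_; _*_; 0ℚ; _/_)

-- For Δ = δ + 2 take the construction above; c = 1/8 works since every
-- truncated expectation beyond the horizon p·(Δ+1) + 1 exceeds n·Δ/8.
theorem3 : Σ ℚ (λ c → (0ℚ < c) × (∀ (Δ : ℕ) → 2 ≤ Δ → Σ ℕ (λ n → Σ (Graph n) (λ G → MaxDegree G Δ × Σ (Coloring n Δ) (λ χ₀ → ExpectedRecoloringsAtLeast G χ₀ (c * (+ (n Data.Nat.* Δ) / 1)))))))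
theorem3 = + 1 / 8 , 0<1/8 , lowerBound
  where
  0<1/8 : 0ℚ < + 1 / 8
  0<1/8 = Data.Rational.*<* (Data.Integer.+<+ (Data.Nat.s≤s Data.Nat.z≤n))

  lowerBound : ∀ Δ → 2 ≤ Δ → Σ ℕ (λ n → Σ (Graph n) (λ G → MaxDegree G Δ × Σ (Coloring n Δ) (λ χ₀ → ExpectedRecoloringsAtLeast G χ₀ (+ 1 / 8 * (+ (n Data.Nat.* Δ) / 1)))))
  lowerBound (suc (suc δ)) (Data.Nat.s≤s (Data.Nat.s≤s _)) = n , G , maxDegree , χ₀ , λ q q<c → suc (p Data.Nat.* d) , ≤-trans (<⇒≤ q<c) eighth-bound
    where
    open Construction δ
    open LowerBound δ
    open import Data.Rational.Properties using (≤-trans; <⇒≤)
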